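{- Let $P$, $V$ be terms of type $tm$ and $T$ a term of type $ty$. If $\vdash P\Downarrow V$ and $\vdash typeof\,P\,T$, then $\vdash typeof\,V\,T$.
   Context: Work in (higher-order, simply typed) intuitionistic logic with types $tm$ (object terms) and $ty$ (object types), constants $abs:(tm\to tm)\to tm$, $app: tm\to tm\to tm$, $gnd: ty$, $arr: ty\to ty\to ty$, and predicates $\Downarrow\,: tm\to tm\to o$ (infix) and $typeof: tm\to ty\to o$. $\vdash F$ means that $F$ is intuitionistically derivable from the following four formulas: $\bigwedge r((abs\,r)\Downarrow(abs\,r))$; $\bigwedge m\bigwedge n\bigwedge v\bigwedge r((m\Downarrow(abs\,r)\ \&\ (r\,n)\Downarrow v)\Rightarrow(app\,m\,n)\Downarrow v)$; $\bigwedge m\bigwedge n\bigwedge t\bigwedge u((typeof\,m\,(arr\,u\,t)\ \&\ typeof\,n\,u)\Rightarrow typeof\,(app\,m\,n)\,t)$; $\bigwedge r\bigwedge t\bigwedge u(\bigwedge x(typeof\,x\,t\Rightarrow typeof\,(r\,x)\,u)\Rightarrow typeof\,(abs\,r)\,(arr\,t\,u))$. Here $\bigwedge$, $\&$, $\Rightarrow$ denote universal quantification, conjunction and implication. -}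

module Defs where

open import Data.List using (List; []; _∷_; map)
open import Data.List.Membership.Propositional using (_∈_)

infixr 7 _⇒_
data Ty : Set where
  tm ty o : Ty
  _⇒_ : Ty → Ty → Ty

-- Types over which one may quantify: simple types not mentioning o.
data NoO : Ty → Set where
  tm  : NoO tm
  ty  : NoO ty
  _⇒_ : ∀ {A B} → NoO A → NoO B → NoO (A ⇒ B)

Ctx : Set
Ctx = List Ty

infix 4 _∋_
data _∋_ : Ctx → Ty → Set where
  ze : ∀ {Γ A} → (A ∷ Γ) ∋ A
  su : ∀ {Γ A B} → Γ ∋ A → (B ∷ Γ) ∋ A

infixl 8 _·_
data Tm (Γ : Ctx) : Ty → Set where
  var     : ∀ {A} → Γ ∋ A → Tm Γ A
  lam     : ∀ {A B} → Tm (A ∷ Γ) B → Tm Γ (A ⇒ B)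
  _·_     : ∀ {A B} → Tm Γ (A ⇒ B) → Tm Γ A → Tm Γ B
  cabs    : Tm Γ ((tm ⇒ tm) ⇒ tm)
  capp    : Tm Γ (tm ⇒ tm ⇒ tm)
  cgnd    : Tm Γ ty
  carr    : Tm Γ (ty ⇒ ty ⇒ ty)
  ceval   : Tm Γ (tm ⇒ tm ⇒ o)
  ctypeof : Tm Γ (tm ⇒ ty ⇒ o)
  cand    : Tm Γ (o ⇒ o ⇒ o)
  cimp    : Tm Γ (o ⇒ o ⇒ o)
  call    : (A : Ty) → NoO A → Tm Γ ((A ⇒ o) ⇒ o)

Ren : Ctx → Ctx → Set
Ren Γ Δ = ∀ {A} → Γ ∋ A → Δ ∋ A

ext : ∀ {Γ Δ B} → Ren Γ Δ → Ren (B ∷ Γ) (B ∷ Δ)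
ext ρ ze     = ze
ext ρ (su x) = su (ρ x)

rename : ∀ {Γ Δ A} → Ren Γ Δ → Tm Γ A → Tm Δ A
rename ρ (var x)    = var (ρ x)
rename ρ (lam t)    = lam (rename (ext ρ) t)
rename ρ (t · u)    = rename ρ t · rename ρ u
rename ρ cabs       = cabs
rename ρ capp       = capp
rename ρ cgnd       = cgnd
rename ρ carr       = carr
rename ρ ceval      = ceval
rename ρ ctypeof    = ctypeof
rename ρ cand       = cand
rename ρ cimp       = cimp
rename ρ (call A p) = call A p

weaken : ∀ {Γ A B} → Tm Γ A → Tm (B ∷ Γ) A
weaken = rename su

Sub : Ctx → Ctx → Set
Sub Γ Δ = ∀ {A} → Γ ∋ A → Tm Δ A

exts : ∀ {Γ Δ B} → Sub Γ Δ → Sub (B ∷ Γ) (B ∷ Δ)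
exts σ ze     = var ze
exts σ (su x) = weaken (σ x)

subst : ∀ {Γ Δ A} → Sub Γ Δ → Tm Γ A → Tm Δ A
subst σ (var x)    = σ x
subst σ (lam t)    = lam (subst (exts σ) t)
subst σ (t · u)    = subst σ t · subst σ u
subst σ cabs       = cabs
subst σ capp       = capp
subst σ cgnd       = cgnd
subst σ carr       = carr
subst σ ceval      = ceval
subst σ ctypeof    = ctypeof
subst σ cand       = cand
subst σ cimp       = cimp
subst σ (call A p) = call A p

single : ∀ {Γ B} → Tm Γ B → Sub (B ∷ Γ) Γ
single u ze     = u
single u (su x) = var x

_[_] : ∀ {Γ A B} → Tm (B ∷ Γ) A → Tm Γ B → Tm Γ A
t [ u ] = subst (single u) t

infix 4 _≈_
data _≈_ {Γ : Ctx} : ∀ {A} → Tm Γ A → Tm Γ A → Set where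
  ≈-refl  : ∀ {A} {t : Tm Γ A} → t ≈ t
  ≈-sym   : ∀ {A} {t u : Tm Γ A} → t ≈ u → u ≈ t
  ≈-trans : ∀ {A} {t u v : Tm Γ A} → t ≈ u → u ≈ v → t ≈ v
  β       : ∀ {A B} (t : Tm (A ∷ Γ) B) (u : Tm Γ A) → lam t · u ≈ t [ u ]
  η       : ∀ {A B} (t : Tm Γ (A ⇒ B)) → lam (weaken t · var ze) ≈ t
  lam-cong : ∀ {A B} {t t' : Tm (A ∷ Γ) B} → t ≈ t' → lam t ≈ lam t'
  app-cong : ∀ {A B} {t t' : Tm Γ (A ⇒ B)} {u u' : Tm Γ A} →
             t ≈ t' → u ≈ u' → t · u ≈ t' · u'

Fm : Ctx → Set
Fm Γ = Tm Γ o

infixr 6 _&_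
infixr 5 _⊃_
_&_ : ∀ {Γ} → Fm Γ → Fm Γ → Fm Γ
F & G = cand · F · G

_⊃_ : ∀ {Γ} → Fm Γ → Fm Γ → Fm Γ
F ⊃ G = cimp · F · G

⋀ : ∀ {Γ} (A : Ty) → NoO A → Fm (A ∷ Γ) → Fm Γ
⋀ A p F = call A p · lam F

-- Natural deduction: Δ is the context of eigenvariables, Γ the hypotheses.
infix 3 _⨾_⊢_
data _⨾_⊢_ (Δ : Ctx) (Γ : List (Fm Δ)) : Fm Δ → Set where
  hyp  : ∀ {F} → F ∈ Γ → Δ ⨾ Γ ⊢ F
  conv : ∀ {F G} → F ≈ G → Δ ⨾ Γ ⊢ F → Δ ⨾ Γ ⊢ G
  &I   : ∀ {F G} → Δ ⨾ Γ ⊢ F → Δ ⨾ Γ ⊢ G → Δ ⨾ Γ ⊢ F & G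
  &E₁  : ∀ {F G} → Δ ⨾ Γ ⊢ F & G → Δ ⨾ Γ ⊢ F
  &E₂  : ∀ {F G} → Δ ⨾ Γ ⊢ F & G → Δ ⨾ Γ ⊢ G
  ⊃I   : ∀ {F G} → Δ ⨾ (F ∷ Γ) ⊢ G → Δ ⨾ Γ ⊢ F ⊃ G
  ⊃E   : ∀ {F G} → Δ ⨾ Γ ⊢ F ⊃ G → Δ ⨾ Γ ⊢ F → Δ ⨾ Γ ⊢ G
  ⋀I   : ∀ {A} {p : NoO A} {P : Tm Δ (A ⇒ o)} →
         (A ∷ Δ) ⨾ map weaken Γ ⊢ weaken P · var ze →
         Δ ⨾ Γ ⊢ call A p · P
  ⋀E   : ∀ {A} {p : NoO A} {P : Tm Δ (A ⇒ o)} →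
         Δ ⨾ Γ ⊢ call A p · P → (t : Tm Δ A) → Δ ⨾ Γ ⊢ P · t

private
  v0 : ∀ {Γ A} → Tm (A ∷ Γ) A
  v0 = var ze
  v1 : ∀ {Γ A B} → Tm (B ∷ A ∷ Γ) A
  v1 = var (su ze)
  v2 : ∀ {Γ A B C} → Tm (C ∷ B ∷ A ∷ Γ) A
  v2 = var (su (su ze))
  v3 : ∀ {Γ A B C D} → Tm (D ∷ C ∷ B ∷ A ∷ Γ) A
  v3 = var (su (su (su ze)))

_⇓_ : ∀ {Γ} → Tm Γ tm → Tm Γ tm → Fm Γ
m ⇓ v = ceval · m · v

typeof : ∀ {Γ} → Tm Γ tm → Tm Γ ty → Fm Γ
typeof m t = ctypeof · m · t

clause₁ : Fm []
clause₁ = ⋀ (tm ⇒ tm) (tm ⇒ tm) ((cabs · v0) ⇓ (cabs · v0))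

-- ⋀m ⋀n ⋀v ⋀r ((m ⇓ abs r & (r n) ⇓ v) ⇒ (app m n) ⇓ v)
clause₂ : Fm []
clause₂ = ⋀ tm tm (⋀ tm tm (⋀ tm tm (⋀ (tm ⇒ tm) (tm ⇒ tm)
            (((v3 ⇓ (cabs · v0)) & ((v0 · v2) ⇓ v1)) ⊃ ((capp · v3 · v2) ⇓ v1)))))

-- ⋀m ⋀n ⋀t ⋀u ((typeof m (arr u t) & typeof n u) ⇒ typeof (app m n) t)
clause₃ : Fm []
clause₃ = ⋀ tm tm (⋀ tm tm (⋀ ty ty (⋀ ty ty
            ((typeof v3 (carr · v0 · v1) & typeof v2 v0) ⊃ typeof (capp · v3 · v2) v1))))

-- ⋀r ⋀t ⋀u (⋀x (typeof x t ⇒ typeof (r x) u) ⇒ typeof (abs r) (arr t u))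
clause₄ : Fm []
clause₄ = ⋀ (tm ⇒ tm) (tm ⇒ tm) (⋀ ty ty (⋀ ty ty
            (⋀ tm tm (typeof v0 v2 ⊃ typeof (v3 · v0) v1)
              ⊃ typeof (cabs · v2) (carr · v1 · v0))))

Program : List (Fm [])
Program = clause₁ ∷ clause₂ ∷ clause₃ ∷ clause₄ ∷ []

infix 2 ⊢_
⊢_ : Fm [] → Set
⊢ F = [] ⨾ Program ⊢ F

-- Interpret the logic in a model where object terms are higher-order abstract
-- syntax trees whose free variables carry their types, typeof is semantic typing and ⇓ is
-- preservation of all semantic types.  Quantifiers range only over values that respect
-- extensional equality and are monotone under replacing free variables by terms of their
-- types; monotonicity is exactly what makes the evaluation clause for app valid, its
-- β-step becoming a semantic substitution lemma.  By soundness ⟦V⟧ has semantic type ⟦T⟧.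
-- A Kripke gluing relation between syntax and semantics, over worlds assigning eigenvariables
-- to semantic free variables, then reads this semantic typing back into a derivation of
-- typeof V T, built from clauses 3 and 4 with a fresh eigenvariable under each abstraction.

module Submission where

open import Defs
open import Data.List using (List; []; _∷_; map)
open import Data.List.Membership.Propositional using (_∈_; _∉_)
open import Data.List.Extrema.Nat using (max; xs≤max)
open import Data.List.Membership.Propositional.Properties using (∈-map⁺; ∈-map⁻)
open import Data.List.Relation.Unary.All as All using ()
open import Data.List.Relation.Unary.Any using (here; there)
open import Data.Empty using (⊥-elim)
open import Data.Nat using (ℕ; zero; suc; _≟_)
open import Data.Nat.Properties using (1+n≰n)
open import Data.Product using (Σ; ∃; _×_; _,_; proj₁; proj₂)
open import Data.Unit using (⊤; tt)
open import Function.Bundles using (_⇔_; mk⇔; module Equivalence)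
open import Level using (Lift; lift; lower)
open import Relation.Binary.PropositionalEquality as ≡
  using (_≡_; _≢_; refl; sym; trans; cong; cong₂)
open import Relation.Nullary using (yes; no)

open Equivalence using (to; from)

≈-reflexive : ∀ {Γ A} {t u : Tm Γ A} → t ≡ u → t ≈ u
≈-reflexive refl = ≈-refl

ext-cong : ∀ {Γ Δ B} {ρ ρ' : Ren Γ Δ} → (∀ {A} (x : Γ ∋ A) → ρ x ≡ ρ' x) →
           ∀ {A} (x : (B ∷ Γ) ∋ A) → ext ρ x ≡ ext ρ' x
ext-cong h ze     = refl
ext-cong h (su x) = cong su (h x)

rename-cong : ∀ {Γ Δ A} {ρ ρ' : Ren Γ Δ} → (∀ {B} (x : Γ ∋ B) → ρ x ≡ ρ' x) →
              (t : Tm Γ A) → rename ρ t ≡ rename ρ' t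
rename-cong h (var x)    = cong var (h x)
rename-cong h (lam t)    = cong lam (rename-cong (ext-cong h) t)
rename-cong h (t · u)    = cong₂ _·_ (rename-cong h t) (rename-cong h u)
rename-cong h cabs       = refl
rename-cong h capp       = refl
rename-cong h cgnd       = refl
rename-cong h carr       = refl
rename-cong h ceval      = refl
rename-cong h ctypeof    = refl
rename-cong h cand       = refl
rename-cong h cimp       = refl
rename-cong h (call A p) = refl

rename-rename : ∀ {Γ Δ Ξ A} (ρ : Ren Δ Ξ) (ρ' : Ren Γ Δ) (t : Tm Γ A) →
                rename ρ (rename ρ' t) ≡ rename (λ x → ρ (ρ' x)) t
rename-rename ρ ρ' (var x)    = refl
rename-rename ρ ρ' (lam t)    =
  cong lam (trans (rename-rename (ext ρ) (ext ρ') t)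
                  (rename-cong (λ { ze → refl ; (su x) → refl }) t))
rename-rename ρ ρ' (t · u)    = cong₂ _·_ (rename-rename ρ ρ' t) (rename-rename ρ ρ' u)
rename-rename ρ ρ' cabs       = refl
rename-rename ρ ρ' capp       = refl
rename-rename ρ ρ' cgnd       = refl
rename-rename ρ ρ' carr       = refl
rename-rename ρ ρ' ceval      = refl
rename-rename ρ ρ' ctypeof    = refl
rename-rename ρ ρ' cand       = refl
rename-rename ρ ρ' cimp       = refl
rename-rename ρ ρ' (call A p) = refl

exts-cong : ∀ {Γ Δ B} {σ σ' : Sub Γ Δ} → (∀ {A} (x : Γ ∋ A) → σ x ≡ σ' x) →
            ∀ {A} (x : (B ∷ Γ) ∋ A) → exts σ x ≡ exts σ' x
exts-cong h ze     = refl
exts-cong h (su x) = cong weaken (h x)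

subst-cong : ∀ {Γ Δ A} {σ σ' : Sub Γ Δ} → (∀ {B} (x : Γ ∋ B) → σ x ≡ σ' x) →
             (t : Tm Γ A) → subst σ t ≡ subst σ' t
subst-cong h (var x)    = h x
subst-cong h (lam t)    = cong lam (subst-cong (exts-cong h) t)
subst-cong h (t · u)    = cong₂ _·_ (subst-cong h t) (subst-cong h u)
subst-cong h cabs       = refl
subst-cong h capp       = refl
subst-cong h cgnd       = refl
subst-cong h carr       = refl
subst-cong h ceval      = refl
subst-cong h ctypeof    = refl
subst-cong h cand       = refl
subst-cong h cimp       = refl
subst-cong h (call A p) = refl

rename-subst : ∀ {Γ Δ Ξ A} (ρ : Ren Δ Ξ) (σ : Sub Γ Δ) (t : Tm Γ A) →
               rename ρ (subst σ t) ≡ subst (λ x → rename ρ (σ x)) t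
rename-subst ρ σ (var x)    = refl
rename-subst ρ σ (lam t)    =
  cong lam (trans (rename-subst (ext ρ) (exts σ) t)
    (subst-cong (λ { ze → refl
                   ; (su x) → trans (rename-rename (ext ρ) su (σ x))
                                    (sym (rename-rename su ρ (σ x))) }) t))
rename-subst ρ σ (t · u)    = cong₂ _·_ (rename-subst ρ σ t) (rename-subst ρ σ u)
rename-subst ρ σ cabs       = refl
rename-subst ρ σ capp       = refl
rename-subst ρ σ cgnd       = refl
rename-subst ρ σ carr       = refl
rename-subst ρ σ ceval      = refl
rename-subst ρ σ ctypeof    = refl
rename-subst ρ σ cand       = refl
rename-subst ρ σ cimp       = refl
rename-subst ρ σ (call A p) = refl

subst-rename : ∀ {Γ Δ Ξ A} (σ : Sub Δ Ξ) (ρ : Ren Γ Δ) (t : Tm Γ A) →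
               subst σ (rename ρ t) ≡ subst (λ x → σ (ρ x)) t
subst-rename σ ρ (var x)    = refl
subst-rename σ ρ (lam t)    =
  cong lam (trans (subst-rename (exts σ) (ext ρ) t)
                  (subst-cong (λ { ze → refl ; (su x) → refl }) t))
subst-rename σ ρ (t · u)    = cong₂ _·_ (subst-rename σ ρ t) (subst-rename σ ρ u)
subst-rename σ ρ cabs       = refl
subst-rename σ ρ capp       = refl
subst-rename σ ρ cgnd       = refl
subst-rename σ ρ carr       = refl
subst-rename σ ρ ceval      = refl
subst-rename σ ρ ctypeof    = refl
subst-rename σ ρ cand       = refl
subst-rename σ ρ cimp       = refl
subst-rename σ ρ (call A p) = refl

subst-subst : ∀ {Γ Δ Ξ A} (σ : Sub Δ Ξ) (τ : Sub Γ Δ) (t : Tm Γ A) →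
              subst σ (subst τ t) ≡ subst (λ x → subst σ (τ x)) t
subst-subst σ τ (var x)    = refl
subst-subst σ τ (lam t)    =
  cong lam (trans (subst-subst (exts σ) (exts τ) t)
    (subst-cong (λ { ze → refl
                   ; (su x) → trans (subst-rename (exts σ) su (τ x))
                                    (sym (rename-subst su σ (τ x))) }) t))
subst-subst σ τ (t · u)    = cong₂ _·_ (subst-subst σ τ t) (subst-subst σ τ u)
subst-subst σ τ cabs       = refl
subst-subst σ τ capp       = refl
subst-subst σ τ cgnd       = refl
subst-subst σ τ carr       = refl
subst-subst σ τ ceval      = refl
subst-subst σ τ ctypeof    = refl
subst-subst σ τ cand       = refl
subst-subst σ τ cimp       = refl
subst-subst σ τ (call A p) = refl

subst-var : ∀ {Γ A} (t : Tm Γ A) → subst var t ≡ t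
subst-var (var x)    = refl
subst-var (lam t)    =
  cong lam (trans (subst-cong (λ { ze → refl ; (su x) → refl }) t) (subst-var t))
subst-var (t · u)    = cong₂ _·_ (subst-var t) (subst-var u)
subst-var cabs       = refl
subst-var capp       = refl
subst-var cgnd       = refl
subst-var carr       = refl
subst-var ceval      = refl
subst-var ctypeof    = refl
subst-var cand       = refl
subst-var cimp       = refl
subst-var (call A p) = refl

subst-id : ∀ {Γ A} {σ : Sub Γ Γ} → (∀ {B} (x : Γ ∋ B) → σ x ≡ var x) →
           (t : Tm Γ A) → subst σ t ≡ t
subst-id h t = trans (subst-cong h t) (subst-var t)

rename-as-subst : ∀ {Γ Δ A} (ρ : Ren Γ Δ) (t : Tm Γ A) →
                  rename ρ t ≡ subst (λ x → var (ρ x)) t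
rename-as-subst ρ t = trans (sym (subst-var (rename ρ t))) (subst-rename var ρ t)

rename-id : ∀ {Γ A} (t : Tm Γ A) → rename (λ x → x) t ≡ t
rename-id t = trans (rename-as-subst (λ x → x) t) (subst-var t)

rename-≈ : ∀ {Γ Δ A} (ρ : Ren Γ Δ) {t u : Tm Γ A} → t ≈ u → rename ρ t ≈ rename ρ u
rename-≈ ρ ≈-refl           = ≈-refl
rename-≈ ρ (≈-sym e)        = ≈-sym (rename-≈ ρ e)
rename-≈ ρ (≈-trans e e')   = ≈-trans (rename-≈ ρ e) (rename-≈ ρ e')
rename-≈ ρ (β t u)          =
  ≈-trans (β (rename (ext ρ) t) (rename ρ u))
    (≈-reflexive (trans (subst-rename (single (rename ρ u)) (ext ρ) t)
                 (trans (subst-cong (λ { ze → refl ; (su x) → refl }) t)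
                        (sym (rename-subst ρ (single u) t)))))
rename-≈ ρ (η t)            =
  ≈-trans (lam-cong (app-cong (≈-reflexive (trans (rename-rename (ext ρ) su t)
                                                  (sym (rename-rename su ρ t))))
                              ≈-refl))
          (η (rename ρ t))
rename-≈ ρ (lam-cong e)     = lam-cong (rename-≈ (ext ρ) e)
rename-≈ ρ (app-cong e e')  = app-cong (rename-≈ ρ e) (rename-≈ ρ e')

infixl 5 _▹_
_▹_ : ∀ {Γ Δ A} → Sub Γ Δ → Tm Δ A → Sub (A ∷ Γ) Δ
(σ ▹ a) ze     = a
(σ ▹ a) (su x) = σ x

β-rename-exts : ∀ {Γ Δ Ξ A B} (ρ : Ren Δ Ξ) (σ : Sub Γ Δ) (t : Tm (A ∷ Γ) B) (s : Tm Ξ A) →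
                rename (ext ρ) (subst (exts σ) t) [ s ] ≡ subst ((λ x → rename ρ (σ x)) ▹ s) t
β-rename-exts ρ σ t s =
  trans (subst-rename (single s) (ext ρ) (subst (exts σ) t))
  (trans (subst-subst (λ x → single s (ext ρ x)) (exts σ) t)
         (subst-cong (λ { ze → refl
                        ; (su x) → trans (subst-rename _ su (σ x))
                                         (sym (rename-as-subst ρ (σ x))) }) t))

data Type : Set where
  gnd : Type
  arr : Type → Type → Type

-- Higher-order abstract syntax in which free variables carry their types, so that typing
-- needs no context; an abstraction may be opened at any type and name.
data Term : Set where
  free : Type → ℕ → Term
  app  : Term → Term → Term
  abs  : (Type → ℕ → Term) → Term

infix 4 _⦂_ _≅_ _⊑_ _≼_

data _⦂_ : Term → Type → Set where
  ⦂free : ∀ {t k} → free t k ⦂ t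
  ⦂app  : ∀ {m n t u} → m ⦂ arr u t → n ⦂ u → app m n ⦂ t
  ⦂abs  : ∀ {b t u} → (∀ k → b t k ⦂ u) → abs b ⦂ arr t u

data _≅_ : Term → Term → Set where
  ≅free : ∀ {t k} → free t k ≅ free t k
  ≅app  : ∀ {m m' n n'} → m ≅ m' → n ≅ n' → app m n ≅ app m' n'
  ≅abs  : ∀ {b b'} → (∀ t k → b t k ≅ b' t k) → abs b ≅ abs b'

≅-sym : ∀ {d d'} → d ≅ d' → d' ≅ d
≅-sym ≅free       = ≅free
≅-sym (≅app e f)  = ≅app (≅-sym e) (≅-sym f)
≅-sym (≅abs h)    = ≅abs (λ t k → ≅-sym (h t k))

≅-trans : ∀ {d d' d''} → d ≅ d' → d' ≅ d'' → d ≅ d''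
≅-trans ≅free      ≅free        = ≅free
≅-trans (≅app e f) (≅app e' f') = ≅app (≅-trans e e') (≅-trans f f')
≅-trans (≅abs h)   (≅abs h')    = ≅abs (λ t k → ≅-trans (h t k) (h' t k))

⦂-resp-≅ : ∀ {d d' T} → d ⦂ T → d ≅ d' → d' ⦂ T
⦂-resp-≅ ⦂free       ≅free       = ⦂free
⦂-resp-≅ (⦂app p q)  (≅app e f)  = ⦂app (⦂-resp-≅ p e) (⦂-resp-≅ q f)
⦂-resp-≅ (⦂abs h)    (≅abs e)    = ⦂abs (λ k → ⦂-resp-≅ (h k) (e _ k))

data _⊑_ : Term → Term → Set where
  ⊑free : ∀ {t k n} → n ⦂ t → free t k ⊑ n
  ⊑app  : ∀ {m m' n n'} → m ⊑ m' → n ⊑ n' → app m n ⊑ app m' n'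
  ⊑abs  : ∀ {b b'} → (∀ t k → b t k ⊑ b' t k) → abs b ⊑ abs b'

⦂-resp-⊑ : ∀ {d d' T} → d ⦂ T → d ⊑ d' → d' ⦂ T
⦂-resp-⊑ ⦂free      (⊑free p)  = p
⦂-resp-⊑ (⦂app p q) (⊑app e f) = ⦂app (⦂-resp-⊑ p e) (⦂-resp-⊑ q f)
⦂-resp-⊑ (⦂abs h)   (⊑abs e)   = ⦂abs (λ k → ⦂-resp-⊑ (h k) (e _ k))

_≼_ : Term → Term → Set
m ≼ v = ∀ {T} → m ⦂ T → v ⦂ T

≼-app : ∀ {m n v} (r : Term → Term) → (∀ {x y} → x ⊑ y → r x ⊑ r y) →
        m ≼ abs (λ t k → r (free t k)) → r n ≼ v → app m n ≼ v
≼-app r r-mono m≼ r≼ (⦂app ⊢m ⊢n) with m≼ ⊢m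
... | ⦂abs ⊢r = r≼ (⦂-resp-⊑ (⊢r zero) (r-mono (⊑free ⊢n)))

-- A model of the logic

⟦_⟧ᵀ : Ty → Set₁
⟦ tm ⟧ᵀ    = Lift _ Term
⟦ ty ⟧ᵀ    = Lift _ Type
⟦ o ⟧ᵀ     = Set
⟦ A ⇒ B ⟧ᵀ = ⟦ A ⟧ᵀ → ⟦ B ⟧ᵀ

-- Quantifiers range over this small copy of the domain, so that formulas denote sets.
Small : ∀ {A} → NoO A → Set
Small tm      = Term
Small ty      = Type
Small (p ⇒ q) = Small p → Small q

↑ : ∀ {A} (p : NoO A) → Small p → ⟦ A ⟧ᵀ
↓ : ∀ {A} (p : NoO A) → ⟦ A ⟧ᵀ → Small p
↑ tm      a = lift a
↑ ty      a = lift a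
↑ (p ⇒ q) f = λ x → ↑ q (f (↓ p x))
↓ tm      x = lower x
↓ ty      x = lower x
↓ (p ⇒ q) f = λ a → ↓ q (f (↑ p a))

Extˢ : ∀ {A} (p : NoO A) → Small p → Small p → Set
Extˢ tm      a b = a ≅ b
Extˢ ty      a b = a ≡ b
Extˢ (p ⇒ q) f g = ∀ x y → Extˢ p x y → Extˢ q (f x) (g y)

Monoˢ : ∀ {A} (p : NoO A) → Small p → Small p → Set
Monoˢ tm      a b = a ⊑ b
Monoˢ ty      a b = a ≡ b
Monoˢ (p ⇒ q) f g = ∀ x y → Monoˢ p x y → Monoˢ q (f x) (g y)

absᵐ : ⟦ (tm ⇒ tm) ⇒ tm ⟧ᵀ
absᵐ f = lift (abs (λ t k → lower (f (lift (free t k)))))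

appᵐ : ⟦ tm ⇒ tm ⇒ tm ⟧ᵀ
appᵐ m n = lift (app (lower m) (lower n))

arrᵐ : ⟦ ty ⇒ ty ⇒ ty ⟧ᵀ
arrᵐ t u = lift (arr (lower t) (lower u))

evalᵐ : ⟦ tm ⇒ tm ⇒ o ⟧ᵀ
evalᵐ m v = lower m ≼ lower v

typeofᵐ : ⟦ tm ⇒ ty ⇒ o ⟧ᵀ
typeofᵐ m t = lower m ⦂ lower t

impᵐ : ⟦ o ⇒ o ⇒ o ⟧ᵀ
impᵐ X Y = X → Y

allᵐ : ∀ {A} (p : NoO A) → ⟦ (A ⇒ o) ⇒ o ⟧ᵀ
allᵐ p P = (a : Small p) → Extˢ p a a → Monoˢ p a a → P (↑ p a)

Env : Ctx → Set₁
Env Γ = ∀ {A} → Γ ∋ A → ⟦ A ⟧ᵀ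

ε : Env []
ε ()

_▸_ : ∀ {Γ A} → Env Γ → ⟦ A ⟧ᵀ → Env (A ∷ Γ)
(ρ ▸ a) ze     = a
(ρ ▸ a) (su x) = ρ x

⟦_⟧ : ∀ {Γ A} → Tm Γ A → Env Γ → ⟦ A ⟧ᵀ
⟦ var x ⟧    ρ = ρ x
⟦ lam t ⟧    ρ = λ a → ⟦ t ⟧ (ρ ▸ a)
⟦ t · u ⟧    ρ = ⟦ t ⟧ ρ (⟦ u ⟧ ρ)
⟦ cabs ⟧     ρ = absᵐ
⟦ capp ⟧     ρ = appᵐ
⟦ cgnd ⟧     ρ = lift gnd
⟦ carr ⟧     ρ = arrᵐ
⟦ ceval ⟧    ρ = evalᵐ
⟦ ctypeof ⟧  ρ = typeofᵐ
⟦ cand ⟧     ρ = _×_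
⟦ cimp ⟧     ρ = impᵐ
⟦ call A p ⟧ ρ = allᵐ p

-- Extensional equality and substitution monotonicity, as logical relations

Ext : (A : Ty) → ⟦ A ⟧ᵀ → ⟦ A ⟧ᵀ → Set₁
Ext tm      a b = Lift _ (lower a ≅ lower b)
Ext ty      a b = Lift _ (lower a ≡ lower b)
Ext o       X Y = Lift _ (X ⇔ Y)
Ext (A ⇒ B) f g = ∀ a b → Ext A a b → Ext B (f a) (g b)

Mono : (A : Ty) → ⟦ A ⟧ᵀ → ⟦ A ⟧ᵀ → Set₁
Mono tm      a b = Lift _ (lower a ⊑ lower b)
Mono ty      a b = Lift _ (lower a ≡ lower b)
Mono o       X Y = Lift _ ⊤
Mono (A ⇒ B) f g = ∀ a b → Mono A a b → Mono B (f a) (g b)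

Ext-sym : ∀ A {a b} → Ext A a b → Ext A b a
Ext-sym tm      (lift e) = lift (≅-sym e)
Ext-sym ty      (lift e) = lift (sym e)
Ext-sym o       (lift e) = lift (mk⇔ (from e) (to e))
Ext-sym (A ⇒ B) h        = λ a b r → Ext-sym B (h b a (Ext-sym A r))

Ext-trans : ∀ A {a b c} → Ext A a b → Ext A b c → Ext A a c
Ext-trans tm      (lift e) (lift e') = lift (≅-trans e e')
Ext-trans ty      (lift e) (lift e') = lift (trans e e')
Ext-trans o       (lift e) (lift e') = lift (mk⇔ (λ x → to e' (to e x)) (λ x → from e (from e' x)))
Ext-trans (A ⇒ B) h h' = λ a c r → Ext-trans B (h a c r) (h' c c (Ext-trans A (Ext-sym A r) r))

Ext-reflˡ : ∀ A {a b} → Ext A a b → Ext A a a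
Ext-reflˡ A r = Ext-trans A r (Ext-sym A r)

Ext-reflʳ : ∀ A {a b} → Ext A a b → Ext A b b
Ext-reflʳ A r = Ext-trans A (Ext-sym A r) r

Extˢ⇒Ext : ∀ {A} (p : NoO A) {a b} → Extˢ p a b → Ext A (↑ p a) (↑ p b)
Ext⇒Extˢ : ∀ {A} (p : NoO A) {x y} → Ext A x y → Extˢ p (↓ p x) (↓ p y)
Extˢ⇒Ext tm      e = lift e
Extˢ⇒Ext ty      e = lift e
Extˢ⇒Ext (p ⇒ q) h = λ _ _ r → Extˢ⇒Ext q (h _ _ (Ext⇒Extˢ p r))
Ext⇒Extˢ tm      e = lower e
Ext⇒Extˢ ty      e = lower e
Ext⇒Extˢ (p ⇒ q) h = λ _ _ r → Ext⇒Extˢ q (h _ _ (Extˢ⇒Ext p r))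

Monoˢ⇒Mono : ∀ {A} (p : NoO A) {a b} → Monoˢ p a b → Mono A (↑ p a) (↑ p b)
Mono⇒Monoˢ : ∀ {A} (p : NoO A) {x y} → Mono A x y → Monoˢ p (↓ p x) (↓ p y)
Monoˢ⇒Mono tm      e = lift e
Monoˢ⇒Mono ty      e = lift e
Monoˢ⇒Mono (p ⇒ q) h = λ _ _ r → Monoˢ⇒Mono q (h _ _ (Mono⇒Monoˢ p r))
Mono⇒Monoˢ tm      e = lower e
Mono⇒Monoˢ ty      e = lower e
Mono⇒Monoˢ (p ⇒ q) h = λ _ _ r → Mono⇒Monoˢ q (h _ _ (Monoˢ⇒Mono p r))

Ext-↑↓ : ∀ {A} (p : NoO A) {x y} → Ext A x y → Ext A (↑ p (↓ p x)) y
Ext-↑↓ tm      e = e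
Ext-↑↓ ty      e = e
Ext-↑↓ (p ⇒ q) h = λ _ b r → Ext-↑↓ q (h _ b (Ext-↑↓ p r))

Ext-absᵐ : Ext ((tm ⇒ tm) ⇒ tm) absᵐ absᵐ
Ext-absᵐ f g h = lift (≅abs (λ t k → lower (h (lift (free t k)) (lift (free t k)) (lift ≅free))))

Ext-appᵐ : Ext (tm ⇒ tm ⇒ tm) appᵐ appᵐ
Ext-appᵐ _ _ (lift e) _ _ (lift e') = lift (≅app e e')

Ext-arrᵐ : Ext (ty ⇒ ty ⇒ ty) arrᵐ arrᵐ
Ext-arrᵐ _ _ (lift e) _ _ (lift e') = lift (cong₂ arr e e')

Ext-evalᵐ : Ext (tm ⇒ tm ⇒ o) evalᵐ evalᵐ
Ext-evalᵐ _ _ (lift e) _ _ (lift e') = lift (mk⇔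
  (λ m≼v {_} ⊢m → ⦂-resp-≅ (m≼v (⦂-resp-≅ ⊢m (≅-sym e))) e')
  (λ m≼v {_} ⊢m → ⦂-resp-≅ (m≼v (⦂-resp-≅ ⊢m e)) (≅-sym e')))

Ext-typeofᵐ : Ext (tm ⇒ ty ⇒ o) typeofᵐ typeofᵐ
Ext-typeofᵐ _ _ (lift e) _ _ (lift refl) = lift (mk⇔ (λ ⊢m → ⦂-resp-≅ ⊢m e) (λ ⊢m → ⦂-resp-≅ ⊢m (≅-sym e)))

Ext-× : Ext (o ⇒ o ⇒ o) _×_ _×_
Ext-× _ _ (lift e) _ _ (lift e') =
  lift (mk⇔ (λ (x , y) → to e x , to e' y) (λ (x , y) → from e x , from e' y))

Ext-impᵐ : Ext (o ⇒ o ⇒ o) impᵐ impᵐ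
Ext-impᵐ _ _ (lift e) _ _ (lift e') =
  lift (mk⇔ (λ f x → to e' (f (from e x))) (λ f x → from e' (f (to e x))))

Ext-allᵐ : ∀ {A} (p : NoO A) → Ext ((A ⇒ o) ⇒ o) (allᵐ p) (allᵐ p)
Ext-allᵐ p P P' h = lift (mk⇔
  (λ f a ra ma → to   (lower (h _ _ (Extˢ⇒Ext p ra))) (f a ra ma))
  (λ f a ra ma → from (lower (h _ _ (Extˢ⇒Ext p ra))) (f a ra ma)))

Mono-absᵐ : Mono ((tm ⇒ tm) ⇒ tm) absᵐ absᵐ
Mono-absᵐ f g h = lift (⊑abs (λ t k → lower (h (lift (free t k)) (lift (free t k)) (lift (⊑free ⦂free)))))

Mono-appᵐ : Mono (tm ⇒ tm ⇒ tm) appᵐ appᵐ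
Mono-appᵐ _ _ (lift e) _ _ (lift e') = lift (⊑app e e')

Mono-arrᵐ : Mono (ty ⇒ ty ⇒ ty) arrᵐ arrᵐ
Mono-arrᵐ _ _ (lift e) _ _ (lift e') = lift (cong₂ arr e e')

ExtEnv : ∀ {Γ} → Env Γ → Env Γ → Set₁
ExtEnv {Γ} ρ ρ' = ∀ {A} (x : Γ ∋ A) → Ext A (ρ x) (ρ' x)

MonoEnv : ∀ {Γ} → Env Γ → Env Γ → Set₁
MonoEnv {Γ} ρ ρ' = ∀ {A} (x : Γ ∋ A) → Mono A (ρ x) (ρ' x)

_▸ᴱ_ : ∀ {Γ A} {ρ ρ' : Env Γ} {a b : ⟦ A ⟧ᵀ} → ExtEnv ρ ρ' → Ext A a b → ExtEnv (ρ ▸ a) (ρ' ▸ b)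
(h ▸ᴱ r) ze     = r
(h ▸ᴱ r) (su x) = h x

_▸ᴹ_ : ∀ {Γ A} {ρ ρ' : Env Γ} {a b : ⟦ A ⟧ᵀ} → MonoEnv ρ ρ' → Mono A a b → MonoEnv (ρ ▸ a) (ρ' ▸ b)
(h ▸ᴹ r) ze     = r
(h ▸ᴹ r) (su x) = h x

Ext-rename : ∀ {Γ Δ A} (t : Tm Γ A) (r : Ren Γ Δ) {ρ : Env Γ} {ρ' : Env Δ} →
             (∀ {B} (x : Γ ∋ B) → Ext B (ρ x) (ρ' (r x))) → Ext A (⟦ t ⟧ ρ) (⟦ rename r t ⟧ ρ')
Ext-rename (var x)    r h = h x
Ext-rename (lam t)    r h = λ a b rab → Ext-rename t (ext r) (λ { ze → rab ; (su x) → h x })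
Ext-rename (t · u)    r h = Ext-rename t r h _ _ (Ext-rename u r h)
Ext-rename cabs       r h = Ext-absᵐ
Ext-rename capp       r h = Ext-appᵐ
Ext-rename cgnd       r h = lift refl
Ext-rename carr       r h = Ext-arrᵐ
Ext-rename ceval      r h = Ext-evalᵐ
Ext-rename ctypeof    r h = Ext-typeofᵐ
Ext-rename cand       r h = Ext-×
Ext-rename cimp       r h = Ext-impᵐ
Ext-rename (call A p) r h = Ext-allᵐ p

Ext-⟦⟧ : ∀ {Γ A} (t : Tm Γ A) {ρ ρ' : Env Γ} → ExtEnv ρ ρ' → Ext A (⟦ t ⟧ ρ) (⟦ t ⟧ ρ')
Ext-⟦⟧ {A = A} t {ρ} {ρ'} h =
  ≡.subst (λ u → Ext A (⟦ t ⟧ ρ) (⟦ u ⟧ ρ')) (rename-id t) (Ext-rename t (λ x → x) h)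

Ext-weaken : ∀ {Γ A B} (t : Tm Γ A) {ρ ρ' : Env Γ} (b : ⟦ B ⟧ᵀ) → ExtEnv ρ ρ' →
             Ext A (⟦ t ⟧ ρ) (⟦ weaken t ⟧ (ρ' ▸ b))
Ext-weaken t b h = Ext-rename t su h

Mono-⟦⟧ : ∀ {Γ A} (t : Tm Γ A) {ρ ρ' : Env Γ} → MonoEnv ρ ρ' → Mono A (⟦ t ⟧ ρ) (⟦ t ⟧ ρ')
Mono-⟦⟧ (var x)    h = h x
Mono-⟦⟧ (lam t)    h = λ a b r → Mono-⟦⟧ t (h ▸ᴹ r)
Mono-⟦⟧ (t · u)    h = Mono-⟦⟧ t h _ _ (Mono-⟦⟧ u h)
Mono-⟦⟧ cabs       h = Mono-absᵐ
Mono-⟦⟧ capp       h = Mono-appᵐ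
Mono-⟦⟧ cgnd       h = lift refl
Mono-⟦⟧ carr       h = Mono-arrᵐ
Mono-⟦⟧ ceval      h = λ _ _ _ _ _ _ → lift tt
Mono-⟦⟧ ctypeof    h = λ _ _ _ _ _ _ → lift tt
Mono-⟦⟧ cand       h = λ _ _ _ _ _ _ → lift tt
Mono-⟦⟧ cimp       h = λ _ _ _ _ _ _ → lift tt
Mono-⟦⟧ (call A p) h = λ _ _ _ → lift tt

Ext-subst : ∀ {Γ Δ A} (t : Tm Γ A) (σ : Sub Γ Δ) {ρ : Env Γ} {ρ' : Env Δ} →
            (∀ {B} (x : Γ ∋ B) → Ext B (ρ x) (⟦ σ x ⟧ ρ')) → ExtEnv ρ' ρ' →
            Ext A (⟦ t ⟧ ρ) (⟦ subst σ t ⟧ ρ')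
Ext-subst (var x)    σ h hρ' = h x
Ext-subst (lam t)    σ h hρ' = λ a b rab → Ext-subst t (exts σ)
  (λ { ze → rab ; (su x) → Ext-trans _ (h x) (Ext-weaken (σ x) b hρ') })
  (hρ' ▸ᴱ Ext-reflʳ _ rab)
Ext-subst (t · u)    σ h hρ' = Ext-subst t σ h hρ' _ _ (Ext-subst u σ h hρ')
Ext-subst cabs       σ h hρ' = Ext-absᵐ
Ext-subst capp       σ h hρ' = Ext-appᵐ
Ext-subst cgnd       σ h hρ' = lift refl
Ext-subst carr       σ h hρ' = Ext-arrᵐ
Ext-subst ceval      σ h hρ' = Ext-evalᵐ
Ext-subst ctypeof    σ h hρ' = Ext-typeofᵐ
Ext-subst cand       σ h hρ' = Ext-×
Ext-subst cimp       σ h hρ' = Ext-impᵐ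
Ext-subst (call A p) σ h hρ' = Ext-allᵐ p

Ext-≈ : ∀ {Γ A} {t u : Tm Γ A} {ρ ρ' : Env Γ} → t ≈ u → ExtEnv ρ ρ' → Ext A (⟦ t ⟧ ρ) (⟦ u ⟧ ρ')
Ext-≈ {t = t} ≈-refl     h = Ext-⟦⟧ t h
Ext-≈ (≈-sym e)          h = Ext-sym _ (Ext-≈ e (λ x → Ext-sym _ (h x)))
Ext-≈ (≈-trans e e')     h = Ext-trans _ (Ext-≈ e h) (Ext-≈ e' (λ x → Ext-reflʳ _ (h x)))
Ext-≈ (β t u)            h = Ext-subst t (single u) (λ { ze → Ext-⟦⟧ u h ; (su x) → h x }) (λ x → Ext-reflʳ _ (h x))
Ext-≈ (η t)              h = λ a b r →
  Ext-trans _ (Ext-sym _ (Ext-weaken t a (λ x → Ext-reflˡ _ (h x)))) (Ext-⟦⟧ t h) a b r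
Ext-≈ (lam-cong e)       h = λ a b r → Ext-≈ e (h ▸ᴱ r)
Ext-≈ (app-cong e e')    h = Ext-≈ e h _ _ (Ext-≈ e' h)

Holds : ∀ {Δ} → Env Δ → List (Fm Δ) → Set
Holds ρ Γ = ∀ {G} → G ∈ Γ → ⟦ G ⟧ ρ

Holds-weaken : ∀ {Δ A} {ρ : Env Δ} {Γ : List (Fm Δ)} → ExtEnv ρ ρ → Holds ρ Γ →
               (a : ⟦ A ⟧ᵀ) → Holds (ρ ▸ a) (map weaken Γ)
Holds-weaken hρ ⊨Γ a G∈ with ∈-map⁻ weaken G∈
... | G , G∈Γ , refl = to (lower (Ext-weaken G a hρ)) (⊨Γ G∈Γ)

sound : ∀ {Δ Γ F} → Δ ⨾ Γ ⊢ F → (ρ : Env Δ) → ExtEnv ρ ρ → MonoEnv ρ ρ → Holds ρ Γ → ⟦ F ⟧ ρ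
sound (hyp F∈)   ρ hρ mρ ⊨Γ = ⊨Γ F∈
sound (conv e d) ρ hρ mρ ⊨Γ = to (lower (Ext-≈ e hρ)) (sound d ρ hρ mρ ⊨Γ)
sound (&I d d')  ρ hρ mρ ⊨Γ = sound d ρ hρ mρ ⊨Γ , sound d' ρ hρ mρ ⊨Γ
sound (&E₁ d)    ρ hρ mρ ⊨Γ = proj₁ (sound d ρ hρ mρ ⊨Γ)
sound (&E₂ d)    ρ hρ mρ ⊨Γ = proj₂ (sound d ρ hρ mρ ⊨Γ)
sound (⊃I d)     ρ hρ mρ ⊨Γ = λ x → sound d ρ hρ mρ (λ { (here refl) → x ; (there G∈) → ⊨Γ G∈ })
sound (⊃E d d')  ρ hρ mρ ⊨Γ = sound d ρ hρ mρ ⊨Γ (sound d' ρ hρ mρ ⊨Γ)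
sound (⋀I {p = p} {P} d) ρ hρ mρ ⊨Γ = λ a ra ma →
  let ra↑ = Extˢ⇒Ext p ra in
  from (lower (Ext-weaken P (↑ p a) hρ _ _ ra↑))
       (sound d (ρ ▸ ↑ p a) (hρ ▸ᴱ ra↑) (mρ ▸ᴹ Monoˢ⇒Mono p ma) (Holds-weaken hρ ⊨Γ (↑ p a)))
sound (⋀E {p = p} {P} d t) ρ hρ mρ ⊨Γ =
  to (lower (Ext-⟦⟧ P hρ _ _ (Ext-↑↓ p (Ext-⟦⟧ t hρ))))
     (sound d ρ hρ mρ ⊨Γ (↓ p (⟦ t ⟧ ρ)) (Ext⇒Extˢ p (Ext-⟦⟧ t hρ)) (Mono⇒Monoˢ p (Mono-⟦⟧ t mρ)))

Program-holds : Holds ε Program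
Program-holds (here refl)                         = λ _ _ _ ⊢abs → ⊢abs
Program-holds (there (here refl))                 =
  λ _ _ _ _ _ _ _ _ _ r _ r-mono (m⇓abs , rn⇓v) →
    ≼-app r (λ {x} {y} x⊑y → r-mono x y x⊑y) m⇓abs rn⇓v
Program-holds (there (there (here refl)))         = λ _ _ _ _ _ _ _ _ _ _ _ _ (⊢m , ⊢n) → ⦂app ⊢m ⊢n
Program-holds (there (there (there (here refl)))) =
  λ _ _ _ t _ _ _ _ _ ⊢body → ⦂abs (λ k → ⊢body (free t k) ≅free (⊑free ⦂free) ⦂free)

sound-closed : ∀ {F} → ⊢ F → ⟦ F ⟧ ε
sound-closed d = sound d ε (λ ()) (λ ()) Program-holds

-- Reading semantic typings back into derivations

⌜_⌝ : ∀ {Γ} → Type → Tm Γ ty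
⌜ gnd ⌝     = cgnd
⌜ arr t u ⌝ = carr · ⌜ t ⌝ · ⌜ u ⌝

rename-⌜⌝ : ∀ {Γ Δ} (ρ : Ren Γ Δ) (t : Type) → rename ρ ⌜ t ⌝ ≡ ⌜ t ⌝
rename-⌜⌝ ρ gnd       = refl
rename-⌜⌝ ρ (arr t u) = cong₂ (λ t' u' → carr · t' · u') (rename-⌜⌝ ρ t) (rename-⌜⌝ ρ u)

update : {X : Set} → (ℕ → X) → ℕ → X → ℕ → X
update f k x k' with k' ≟ k
... | yes _ = x
... | no  _ = f k'

update-here : ∀ {X : Set} (f : ℕ → X) k x → update f k x k ≡ x
update-here f k x with k ≟ k
... | yes _  = refl
... | no k≢k = ⊥-elim (k≢k refl)

update-there : ∀ {X : Set} (f : ℕ → X) {k k'} x → k' ≢ k → update f k x k' ≡ f k'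
update-there f {k} {k'} x k'≢k with k' ≟ k
... | yes k'≡k = ⊥-elim (k'≢k k'≡k)
... | no  _    = refl

-- The semantic free variable named k stands for the syntactic term `term k` of type
-- `type k`; both fields are junk outside `names`.
record World : Set where
  field
    ctx   : Ctx
    names : List ℕ
    term  : ℕ → Tm ctx tm
    type  : ℕ → Type
open World

extend : World → Type → ℕ → World
extend w t k = record
  { ctx   = tm ∷ ctx w
  ; names = k ∷ names w
  ; term  = update (λ k' → weaken (term w k')) k (var ze)
  ; type  = update (type w) k t
  }

infix 4 _≤ʷ_
record _≤ʷ_ (w w' : World) : Set where
  field
    ren    : Ren (ctx w) (ctx w')
    names⊆ : ∀ {k} → k ∈ names w → k ∈ names w'
    term≡  : ∀ {k} → k ∈ names w → term w' k ≡ rename ren (term w k)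
    type≡  : ∀ {k} → k ∈ names w → type w' k ≡ type w k
open _≤ʷ_

≤ʷ-refl : ∀ {w} → w ≤ʷ w
≤ʷ-refl = record
  { ren = λ x → x ; names⊆ = λ k∈ → k∈ ; term≡ = λ _ → sym (rename-id _) ; type≡ = λ _ → refl }

≤ʷ-trans : ∀ {w w' w''} → w ≤ʷ w' → w' ≤ʷ w'' → w ≤ʷ w''
≤ʷ-trans e e' = record
  { ren    = λ x → ren e' (ren e x)
  ; names⊆ = λ k∈ → names⊆ e' (names⊆ e k∈)
  ; term≡  = λ k∈ → trans (term≡ e' (names⊆ e k∈))
                     (trans (cong (rename (ren e')) (term≡ e k∈)) (rename-rename (ren e') (ren e) _))
  ; type≡  = λ k∈ → trans (type≡ e' (names⊆ e k∈)) (type≡ e k∈)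
  }

∈⇒≢ : ∀ {k k' : ℕ} {ns} → k ∉ ns → k' ∈ ns → k' ≢ k
∈⇒≢ k∉ k'∈ refl = k∉ k'∈

≤ʷ-extend : ∀ {w t k} → k ∉ names w → w ≤ʷ extend w t k
≤ʷ-extend {w} {t} k∉ = record
  { ren    = su
  ; names⊆ = there
  ; term≡  = λ k'∈ → update-there _ (var ze) (∈⇒≢ k∉ k'∈)
  ; type≡  = λ k'∈ → update-there (type w) t (∈⇒≢ k∉ k'∈)
  }

extend-mono : ∀ {w w' t k} → w ≤ʷ w' → extend w t k ≤ʷ extend w' t k
extend-mono {w} {w'} {t} {k} e = record
  { ren    = ext (ren e)
  ; names⊆ = λ { (here k'≡k) → here k'≡k ; (there k'∈) → there (names⊆ e k'∈) }
  ; term≡  = term≡′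
  ; type≡  = type≡′
  }
  where
  term≡′ : ∀ {k'} → k' ∈ k ∷ names w → term (extend w' t k) k' ≡ rename (ext (ren e)) (term (extend w t k) k')
  term≡′ {k'} k'∈ with k' ≟ k | k'∈
  ... | yes _   | _          = refl
  ... | no k'≢k | here k'≡k  = ⊥-elim (k'≢k k'≡k)
  ... | no _    | there k'∈w = trans (cong weaken (term≡ e k'∈w))
    (trans (rename-rename su (ren e) _) (sym (rename-rename (ext (ren e)) su _)))
  type≡′ : ∀ {k'} → k' ∈ k ∷ names w → type (extend w' t k) k' ≡ type (extend w t k) k'
  type≡′ {k'} k'∈ with k' ≟ k | k'∈
  ... | yes _   | _          = refl
  ... | no k'≢k | here k'≡k  = ⊥-elim (k'≢k k'≡k)
  ... | no _    | there k'∈w = type≡ e k'∈w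

Gl-tm : (w : World) → Tm (ctx w) tm → Term → Set
Gl-tm w s (free t k) = k ∈ names w × s ≈ term w k × type w k ≡ t
Gl-tm w s (app d e)  = Σ (Tm (ctx w) tm) λ s₁ → Σ (Tm (ctx w) tm) λ s₂ →
                         s ≈ capp · s₁ · s₂ × Gl-tm w s₁ d × Gl-tm w s₂ e
Gl-tm w s (abs b)    = Σ (Tm (ctx w) (tm ⇒ tm)) λ r → s ≈ cabs · r ×
                         (∀ t k → k ∉ names w → Gl-tm (extend w t k) (weaken r · var ze) (b t k))

Gl-tm-≈ : ∀ {w s s'} (d : Term) → Gl-tm w s d → s ≈ s' → Gl-tm w s' d
Gl-tm-≈ (free t k) (k∈ , s≈ , t≡)      e = k∈ , ≈-trans (≈-sym e) s≈ , t≡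
Gl-tm-≈ (app d d') (s₁ , s₂ , s≈ , g)  e = s₁ , s₂ , ≈-trans (≈-sym e) s≈ , g
Gl-tm-≈ (abs b)    (r , s≈ , g)        e = r , ≈-trans (≈-sym e) s≈ , g

Gl-tm-mono : ∀ {w w' s} (d : Term) → Gl-tm w s d → (e : w ≤ʷ w') → Gl-tm w' (rename (ren e) s) d
Gl-tm-mono (free t k) (k∈ , s≈ , t≡) e =
  names⊆ e k∈ , ≈-trans (rename-≈ (ren e) s≈) (≈-reflexive (sym (term≡ e k∈))) , trans (type≡ e k∈) t≡
Gl-tm-mono (app d d') (s₁ , s₂ , s≈ , g , g') e =
  rename (ren e) s₁ , rename (ren e) s₂ , rename-≈ (ren e) s≈ , Gl-tm-mono d g e , Gl-tm-mono d' g' e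
Gl-tm-mono (abs b) (r , s≈ , g) e = rename (ren e) r , rename-≈ (ren e) s≈ , λ t k k∉ →
  Gl-tm-≈ (b t k) (Gl-tm-mono (b t k) (g t k (λ k∈ → k∉ (names⊆ e k∈))) (extend-mono e))
    (app-cong (≈-reflexive (trans (rename-rename (ext (ren e)) su r) (sym (rename-rename su (ren e) r))))
              ≈-refl)

Gl-tm-fresh : ∀ {w} t k → Gl-tm (extend w t k) (var ze) (free t k)
Gl-tm-fresh {w} t k =
  here refl , ≈-reflexive (sym (update-here _ k (var ze))) , update-here (type w) k t

Gl : (A : Ty) (w : World) → Tm (ctx w) A → ⟦ A ⟧ᵀ → Set₁
Gl tm      w s v = Lift _ (Gl-tm w s (lower v))
Gl ty      w s v = Lift _ (s ≈ ⌜ lower v ⌝)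
Gl o       w s v = Lift _ ⊤
Gl (A ⇒ B) w s f = ∀ w' (e : w ≤ʷ w') (s' : Tm (ctx w') A) (v : ⟦ A ⟧ᵀ) → Gl A w' s' v →
                     Gl B w' (rename (ren e) s · s') (f v)

Gl-≈ : ∀ A {w s s' v} → Gl A w s v → s ≈ s' → Gl A w s' v
Gl-≈ tm      {v = v} g e = lift (Gl-tm-≈ (lower v) (lower g) e)
Gl-≈ ty      g e = lift (≈-trans (≈-sym e) (lower g))
Gl-≈ o       g e = g
Gl-≈ (A ⇒ B) g e = λ w' e' s' v g' → Gl-≈ B (g w' e' s' v g') (app-cong (rename-≈ (ren e') e) ≈-refl)

Gl-mono : ∀ A {w w' s v} → Gl A w s v → (e : w ≤ʷ w') → Gl A w' (rename (ren e) s) v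
Gl-mono tm      {v = v} g e = lift (Gl-tm-mono (lower v) (lower g) e)
Gl-mono ty      {v = v} g e = lift (≈-trans (rename-≈ (ren e) (lower g)) (≈-reflexive (rename-⌜⌝ (ren e) (lower v))))
Gl-mono o       g e = g
Gl-mono (A ⇒ B) {s = s} g e = λ w'' e' s' v g' →
  Gl-≈ B (g w'' (≤ʷ-trans e e') s' v g') (app-cong (≈-reflexive (sym (rename-rename (ren e') (ren e) s))) ≈-refl)

GlEnv : ∀ {Γ} (w : World) → Sub Γ (ctx w) → Env Γ → Set₁
GlEnv {Γ} w σ ρ = ∀ {A} (x : Γ ∋ A) → Gl A w (σ x) (ρ x)

GlEnv-mono : ∀ {Γ w w'} {σ : Sub Γ (ctx w)} {ρ : Env Γ} → GlEnv w σ ρ → (e : w ≤ʷ w') →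
             GlEnv w' (λ x → rename (ren e) (σ x)) ρ
GlEnv-mono h e x = Gl-mono _ (h x) e

glue : ∀ {Γ A} (t : Tm Γ A) {w : World} {σ : Sub Γ (ctx w)} {ρ : Env Γ} → GlEnv w σ ρ →
       Gl A w (subst σ t) (⟦ t ⟧ ρ)
glue (var x) h = h x
glue {A = A ⇒ B} (lam t) {σ = σ} h = λ w' e s' v g →
  Gl-≈ B (glue t {σ = (λ x → rename (ren e) (σ x)) ▹ s'} (λ { ze → g ; (su x) → GlEnv-mono h e x }))
       (≈-sym (≈-trans (β _ _) (≈-reflexive (β-rename-exts (ren e) σ t s'))))
glue {A = B} (t · u) {w} {σ} h =
  Gl-≈ B (glue t h w ≤ʷ-refl (subst σ u) _ (glue u h)) (app-cong (≈-reflexive (rename-id _)) ≈-refl)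
glue cabs h = λ w' e s' f g → lift (s' , ≈-refl , λ t k k∉ →
  lower (g (extend w' t k) (≤ʷ-extend k∉) (var ze) (lift (free t k)) (lift (Gl-tm-fresh t k))))
glue capp h = λ _ _ s₁ m g₁ _ e₂ s₂ _ g₂ →
  lift (rename (ren e₂) s₁ , s₂ , ≈-refl , Gl-tm-mono (lower m) (lower g₁) e₂ , lower g₂)
glue cgnd h = lift ≈-refl
glue carr h = λ _ _ _ t g₁ _ e₂ _ _ g₂ →
  lift (app-cong (app-cong ≈-refl (≈-trans (rename-≈ (ren e₂) (lower g₁)) (≈-reflexive (rename-⌜⌝ _ (lower t)))))
                 (lower g₂))
glue ceval      h = λ _ _ _ _ _ _ _ _ _ _ → lift tt
glue ctypeof    h = λ _ _ _ _ _ _ _ _ _ _ → lift tt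
glue cand       h = λ _ _ _ _ _ _ _ _ _ _ → lift tt
glue cimp       h = λ _ _ _ _ _ _ _ _ _ _ → lift tt
glue (call A p) h = λ _ _ _ _ _ → lift tt

empty : ∀ {Δ} → Sub [] Δ
empty ()

closed : ∀ {Δ A} → Tm [] A → Tm Δ A
closed = subst empty

weaken-closed : ∀ {Δ A B} (c : Tm [] A) → weaken {B = B} (closed {Δ} c) ≡ closed c
weaken-closed c = trans (rename-subst su empty c) (subst-cong (λ ()) c)

weaken-lam-· : ∀ {Δ A B} (F : Tm (A ∷ Δ) B) → weaken (lam F) · var ze ≈ F
weaken-lam-· F = ≈-trans (β _ _) (≈-reflexive (trans (subst-rename _ _ F)
                                               (subst-id (λ { ze → refl ; (su x) → refl }) F)))

⋀E-subst : ∀ {Δ Ξ A} {p : NoO A} {Γ : List (Fm Δ)} (F : Fm (A ∷ Ξ)) (σ : Sub Ξ Δ) (a : Tm Δ A) →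
           Δ ⨾ Γ ⊢ subst σ (⋀ A p F) → Δ ⨾ Γ ⊢ subst (σ ▹ a) F
⋀E-subst F σ a d = conv (≈-trans (β _ a) (≈-reflexive (trans (subst-subst (single a) (exts σ) F)
  (subst-cong (λ { ze → refl ; (su x) → trans (subst-rename (single a) su (σ x)) (subst-var (σ x)) }) F))))
  (⋀E d a)

Clauses : ∀ {Δ} → List (Fm Δ) → Set
Clauses Γ = closed clause₃ ∈ Γ × closed clause₄ ∈ Γ

Clauses-weaken : ∀ {Δ A} {Γ : List (Fm Δ)} (G : Fm (A ∷ Δ)) → Clauses Γ → Clauses (G ∷ map weaken Γ)
Clauses-weaken {A = A} {Γ} G (c₃ , c₄) = there (weaken∈ clause₃ c₃) , there (weaken∈ clause₄ c₄)
  where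
  weaken∈ : ∀ c → closed c ∈ Γ → closed c ∈ map (weaken {B = A}) Γ
  weaken∈ c c∈ = ≡.subst (_∈ map weaken Γ) (weaken-closed c) (∈-map⁺ weaken c∈)

clause₃-rule : ∀ {Δ Γ} {m n : Tm Δ tm} {t u : Tm Δ ty} → Clauses Γ →
               Δ ⨾ Γ ⊢ typeof m (carr · u · t) → Δ ⨾ Γ ⊢ typeof n u → Δ ⨾ Γ ⊢ typeof (capp · m · n) t
clause₃-rule {m = m} {n} {t} {u} (c₃ , _) ⊢m ⊢n =
  ⊃E (⋀E-subst B (empty ▹ m ▹ n ▹ t) u
     (⋀E-subst (⋀ ty ty B) (empty ▹ m ▹ n) t
     (⋀E-subst (⋀ ty ty (⋀ ty ty B)) (empty ▹ m) n
     (⋀E-subst (⋀ tm tm (⋀ ty ty (⋀ ty ty B))) empty m (hyp c₃)))))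
     (&I ⊢m ⊢n)
  where
  -- The body of clause₃, spelled out since it cannot be inferred from its substitution instances.
  B : Fm (ty ∷ ty ∷ tm ∷ tm ∷ [])
  B = (typeof (var (su (su (su ze)))) (carr · var ze · var (su ze)) & typeof (var (su (su ze))) (var ze))
      ⊃ typeof (capp · var (su (su (su ze))) · var (su (su ze))) (var (su ze))

clause₄-rule : ∀ {Δ Γ} {r : Tm Δ (tm ⇒ tm)} {t u : Tm Δ ty} → Clauses Γ →
               (tm ∷ Δ) ⨾ typeof (var ze) (weaken t) ∷ map weaken Γ ⊢ typeof (weaken r · var ze) (weaken u) →
               Δ ⨾ Γ ⊢ typeof (cabs · r) (carr · t · u)
clause₄-rule {r = r} {t} {u} (_ , c₄) ⊢body =
  ⊃E (⋀E-subst B (empty ▹ r ▹ t) u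
     (⋀E-subst (⋀ ty ty B) (empty ▹ r) t
     (⋀E-subst (⋀ ty ty (⋀ ty ty B)) empty r (hyp c₄))))
     (⋀I (conv (≈-sym (weaken-lam-· _))
               (⊃I ⊢body)))
  where
  B : Fm (ty ∷ ty ∷ (tm ⇒ tm) ∷ [])
  B = ⋀ tm tm (typeof (var ze) (var (su (su ze))) ⊃ typeof (var (su (su (su ze))) · var ze) (var (su ze)))
      ⊃ typeof (cabs · var (su (su ze))) (carr · var (su ze) · var ze)

Assumed : (w : World) → List (Fm (ctx w)) → Set
Assumed w Γ = ∀ {k} → k ∈ names w → typeof (term w k) ⌜ type w k ⌝ ∈ Γ

Assumed-extend : ∀ {w Γ} t k → Assumed w Γ →
                 Assumed (extend w t k) (typeof (var ze) (weaken ⌜ t ⌝) ∷ map weaken Γ)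
Assumed-extend {w} {Γ} t k hyps {k'} k'∈ with k' ≟ k | k'∈
... | yes _   | _          = here (cong (typeof (var ze)) (sym (rename-⌜⌝ su t)))
... | no k'≢k | here k'≡k  = ⊥-elim (k'≢k k'≡k)
... | no _    | there k'∈w =
  there (≡.subst (_∈ map weaken Γ) (cong (typeof _) (rename-⌜⌝ su (type w k'))) (∈-map⁺ weaken (hyps k'∈w)))

fresh : (ns : List ℕ) → ∃ λ k → k ∉ ns
fresh ns = suc (max 0 ns) , λ k∈ → 1+n≰n (All.lookup (xs≤max 0 ns) k∈)

typeof-congˡ : ∀ {Δ} {s s' : Tm Δ tm} {t : Tm Δ ty} → s ≈ s' → typeof s t ≈ typeof s' t
typeof-congˡ e = app-cong (app-cong ≈-refl e) ≈-refl

reify : ∀ {w Γ d T s} → Assumed w Γ → Clauses Γ → d ⦂ T → Gl-tm w s d → ctx w ⨾ Γ ⊢ typeof s ⌜ T ⌝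
reify hyps cl ⦂free (k∈ , s≈ , refl) = conv (typeof-congˡ (≈-sym s≈)) (hyp (hyps k∈))
reify hyps cl (⦂app ⊢m ⊢n) (s₁ , s₂ , s≈ , g₁ , g₂) =
  conv (typeof-congˡ (≈-sym s≈)) (clause₃-rule cl (reify hyps cl ⊢m g₁) (reify hyps cl ⊢n g₂))
reify {w} hyps cl (⦂abs {t = t} {u} ⊢b) (r , s≈ , g) with fresh (names w)
... | k , k∉ = conv (typeof-congˡ (≈-sym s≈)) (clause₄-rule cl
      (≡.subst (λ u' → _ ⨾ _ ⊢ typeof _ u') (sym (rename-⌜⌝ su u))
        (reify (Assumed-extend t k hyps) (Clauses-weaken _ cl) (⊢b k) (g t k k∉))))

w₀ : World
w₀ = record { ctx = [] ; names = [] ; term = λ _ → cabs · lam (var ze) ; type = λ _ → gnd }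

glue-closed : ∀ {A} (t : Tm [] A) → Gl A w₀ t (⟦ t ⟧ ε)
glue-closed {A} t = ≡.subst (λ u → Gl A w₀ u (⟦ t ⟧ ε)) (subst-id {σ = empty} (λ ()) t) (glue t (λ ()))

Program-clauses : Clauses Program
Program-clauses = closed∈ clause₃ (there (there (here refl))) , closed∈ clause₄ (there (there (there (here refl))))
  where
  closed∈ : ∀ c → c ∈ Program → closed c ∈ Program
  closed∈ c = ≡.subst (_∈ Program) (sym (subst-id {σ = empty} (λ ()) c))

proposition7p1 : (P V : Tm [] tm) (T : Tm [] ty) →
    ⊢ (P ⇓ V) → ⊢ typeof P T → ⊢ typeof V T
proposition7p1 P V T ⊢P⇓V ⊢P⦂T =
  conv (app-cong ≈-refl (≈-sym (lower (glue-closed T))))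
       (reify (λ ()) Program-clauses ⟦V⟧⦂⟦T⟧ (lower (glue-closed V)))
  where
  ⟦V⟧⦂⟦T⟧ : lower (⟦ V ⟧ ε) ⦂ lower (⟦ T ⟧ ε)
  ⟦V⟧⦂⟦T⟧ = sound-closed ⊢P⇓V (sound-closed ⊢P⦂T)
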